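{- Let $q_1,q_2$ be real numbers with $0<q_1,q_2\le1$ and let $m,n$ be positive integers such that $q_1m$ and $q_2n$ are integers. If $H$ is a connected signed bipartite graph, then $$z(m,n,H)\ge\frac{1}{2\max\{q_1,q_2\}}\,z(q_1m,q_2n,H).$$
   Context: A signed bipartite graph is a bipartite graph $H=(H_1,H_2)$ with a fixed ordered bipartition. A signed copy of $H=(H_1,H_2)$ in a signed bipartite graph $G=(G_1,G_2)$ is a copy of $H$ in $G$ with $H_1$ mapped into $G_1$ and $H_2$ into $G_2$. The Zarankiewicz number $z(m,n,H)$ is the maximum number of edges of a signed bipartite graph $G=(G_1,G_2)$ with $|G_1|=m$, $|G_2|=n$ containing no signed copy of $H$. -}

module Defs where

open import Data.Nat using (ℕ; _+_; _≤_)
open import Data.Bool using (Bool; true; false; if_then_else_)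
open import Data.Fin using (Fin)
open import Data.List using (List; map; allFin)
open import Data.Nat.ListAction using (sum)
open import Data.Sum using (_⊎_; inj₁; inj₂)
open import Data.Product using (Σ-syntax; _×_)
open import Data.Empty using (⊥)
open import Function.Definitions using (Injective)
open import Relation.Binary.PropositionalEquality using (_≡_)

-- A signed bipartite graph G = (G₁, G₂) with fixed ordered bipartition:
-- G₁ = Fin left, G₂ = Fin right, edges given by a Boolean adjacency relation.
record SBG : Set where
  constructor sbg
  field
    left  : ℕ
    right : ℕ
    adj   : Fin left → Fin right → Bool
open SBG public

edges : SBG → ℕ
edges G = sum (map (λ i → sum (map (λ j → if adj G i j then 1 else 0)
                                    (allFin (right G))))
                   (allFin (left G)))

SignedCopy : SBG → SBG → Set
SignedCopy H G =
  Σ[ f ∈ (Fin (left H) → Fin (left G)) ]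
  Σ[ g ∈ (Fin (right H) → Fin (right G)) ]
    Injective _≡_ _≡_ f × Injective _≡_ _≡_ g ×
    (∀ i j → adj H i j ≡ true → adj G (f i) (g j) ≡ true)

HFree : SBG → SBG → Set
HFree H G = SignedCopy H G → ⊥

Vertex : SBG → Set
Vertex H = Fin (left H) ⊎ Fin (right H)

Adj : (H : SBG) → Vertex H → Vertex H → Set
Adj H (inj₁ i) (inj₂ j) = adj H i j ≡ true
Adj H (inj₂ j) (inj₁ i) = adj H i j ≡ true
Adj H (inj₁ _) (inj₁ _) = ⊥
Adj H (inj₂ _) (inj₂ _) = ⊥

data Reach (H : SBG) : Vertex H → Vertex H → Set where
  here : ∀ {u} → Reach H u u
  step : ∀ {u v w} → Adj H u v → Reach H v w → Reach H u w

Connected : SBG → Set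
Connected H = (1 ≤ left H + right H) × (∀ u v → Reach H u v)

IsZ : ℕ → ℕ → SBG → ℕ → Set
IsZ m n H k =
  (Σ[ G ∈ (Fin m → Fin n → Bool) ] HFree H (sbg m n G) × edges (sbg m n G) ≡ k)
  × (∀ (G : Fin m → Fin n → Bool) → HFree H (sbg m n G) → edges (sbg m n G) ≤ k)

module Submission where

open import Defs
open import Data.Nat using (ℕ; zero; suc; _+_; _*_; _∸_; _≤_; _⊔_; _⊓_; s≤s; z≤n; NonZero)
open import Data.Nat.Properties
  using (+-identityʳ; *-identityˡ; *-assoc; ≤-reflexive; ≤-trans; <⇒≤; +-monoˡ-≤; *-monoˡ-≤; *-monoʳ-≤;
         m+[n∸m]≡n; ⊓-sel; ⊓-comm; m⊓n≤m; m≤m⊔n; m≤n⊔m; module ≤-Reasoning)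
open import Data.Nat.DivMod using (_/_; _%_; m≡m%n+[m/n]*n; m%n<n; m/n*n≤m; m≥n⇒m/n>0)
open import Data.Nat.ListAction using (sum)
open import Data.Nat.ListAction.Properties using (sum-++)
open import Data.Nat.Solver using (module +-*-Solver)
open import Data.Bool using (Bool; true; false; if_then_else_)
open import Data.Fin as Fin using (Fin; splitAt; join; _↑ˡ_; _↑ʳ_)
open import Data.Fin.Properties using (splitAt-join; join-splitAt)
open import Data.List using (List; []; _∷_; _++_; map; allFin; tabulate)
open import Data.List.Properties using (map-tabulate; map-cong)
open import Data.Sum using (_⊎_; inj₁; inj₂; [_,_])
open import Data.Sum.Properties using (inj₁-injective; inj₂-injective)
open import Data.Product using (_,_)
open import Data.Empty using (⊥; ⊥-elim)
open import Function using (_∘_)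
open import Relation.Binary.PropositionalEquality using (_≡_; refl; sym; trans; cong; cong₂; subst; module ≡-Reasoning)

-- Let k = min(⌊m/a⌋, ⌊n/b⌋). Since H is connected, every signed copy of H in a
-- disjoint union of signed bipartite graphs lies inside one of them, so k disjoint copies of
-- an extremal H-free graph on (a, b), padded with isolated vertices, form an H-free graph on
-- (m, n) with k·z(a,b,H) edges. Hence z(m,n,H) ≥ k·z(a,b,H), and mn ≤ 2·max(an, bm)·k
-- because ⌊m/a⌋·a > m/2.

∑ : (n : ℕ) → (Fin n → ℕ) → ℕ
∑ n f = sum (map f (allFin n))

∑-cong : ∀ n {f g : Fin n → ℕ} → (∀ i → f i ≡ g i) → ∑ n f ≡ ∑ n g
∑-cong n f≗g = cong sum (map-cong f≗g (allFin n))

sum-map-zero : ∀ {A : Set} (xs : List A) → sum (map (λ _ → 0) xs) ≡ 0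
sum-map-zero []       = refl
sum-map-zero (_ ∷ xs) = sum-map-zero xs

∑-zero : ∀ n → ∑ n (λ _ → 0) ≡ 0
∑-zero n = sum-map-zero (allFin n)

tabulate-+ : ∀ {A : Set} m {n} (f : Fin (m + n) → A) →
             tabulate f ≡ tabulate (f ∘ (_↑ˡ n)) ++ tabulate (f ∘ (m ↑ʳ_))
tabulate-+ zero    f = refl
tabulate-+ (suc m) f = cong (f Fin.zero ∷_) (tabulate-+ m (f ∘ Fin.suc))

∑-tabulate : ∀ n (f : Fin n → ℕ) → ∑ n f ≡ sum (tabulate f)
∑-tabulate n f = cong sum (map-tabulate (λ i → i) f)

∑-+ : ∀ m n (f : Fin (m + n) → ℕ) → ∑ (m + n) f ≡ ∑ m (f ∘ (_↑ˡ n)) + ∑ n (f ∘ (m ↑ʳ_))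
∑-+ m n f = begin
  ∑ (m + n) f                                                  ≡⟨ ∑-tabulate (m + n) f ⟩
  sum (tabulate f)                                             ≡⟨ cong sum (tabulate-+ m f) ⟩
  sum (tabulate (f ∘ (_↑ˡ n)) ++ tabulate (f ∘ (m ↑ʳ_)))       ≡⟨ sum-++ (tabulate (f ∘ (_↑ˡ n))) _ ⟩
  sum (tabulate (f ∘ (_↑ˡ n))) + sum (tabulate (f ∘ (m ↑ʳ_)))  ≡⟨ sym (cong₂ _+_ (∑-tabulate m _) (∑-tabulate n _)) ⟩
  ∑ m (f ∘ (_↑ˡ n)) + ∑ n (f ∘ (m ↑ʳ_))                        ∎
  where open ≡-Reasoning

emptyGraph : ℕ → ℕ → SBG
emptyGraph l r = sbg l r (λ _ _ → false)

blockDiagonal : ∀ {l₁ l₂ r₁ r₂} → (Fin l₁ → Fin r₁ → Bool) → (Fin l₂ → Fin r₂ → Bool) →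
                Fin l₁ ⊎ Fin l₂ → Fin r₁ ⊎ Fin r₂ → Bool
blockDiagonal A B (inj₁ i) (inj₁ j) = A i j
blockDiagonal A B (inj₂ i) (inj₂ j) = B i j
blockDiagonal A B (inj₁ _) (inj₂ _) = false
blockDiagonal A B (inj₂ _) (inj₁ _) = false

infixr 5 _⊕_

_⊕_ : SBG → SBG → SBG
G₁ ⊕ G₂ = sbg (left G₁ + left G₂) (right G₁ + right G₂) λ x y →
  blockDiagonal (adj G₁) (adj G₂) (splitAt (left G₁) x) (splitAt (right G₁) y)

copies : ℕ → SBG → SBG
copies zero    G = emptyGraph 0 0
copies (suc k) G = G ⊕ copies k G

left-copies : ∀ k G → left (copies k G) ≡ k * left G
left-copies zero    G = refl
left-copies (suc k) G = cong (left G +_) (left-copies k G)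

right-copies : ∀ k G → right (copies k G) ≡ k * right G
right-copies zero    G = refl
right-copies (suc k) G = cong (right G +_) (right-copies k G)

indicator : Bool → ℕ
indicator b = if b then 1 else 0

edges-emptyGraph : ∀ l r → edges (emptyGraph l r) ≡ 0
edges-emptyGraph l r = trans (∑-cong l (λ _ → ∑-zero r)) (∑-zero l)

degree : (G : SBG) → Fin (left G) → ℕ
degree G i = ∑ (right G) (λ j → indicator (adj G i j))

module _ (G₁ G₂ : SBG) where
  private
    l₁ = left G₁
    l₂ = left G₂
    r₁ = right G₁
    r₂ = right G₂
    A  = adj G₁
    B  = adj G₂

  adj-⊕-join : ∀ s t → adj (G₁ ⊕ G₂) (join l₁ l₂ s) (join r₁ r₂ t) ≡ blockDiagonal A B s t
  adj-⊕-join s t = cong₂ (blockDiagonal A B) (splitAt-join l₁ l₂ s) (splitAt-join r₁ r₂ t)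

  degree-⊕-join : ∀ s → degree (G₁ ⊕ G₂) (join l₁ l₂ s)
                      ≡ ∑ r₁ (λ j → indicator (blockDiagonal A B s (inj₁ j)))
                        + ∑ r₂ (λ j → indicator (blockDiagonal A B s (inj₂ j)))
  degree-⊕-join s = trans (∑-+ r₁ r₂ _)
    (cong₂ _+_ (∑-cong r₁ λ j → cong indicator (adj-⊕-join s (inj₁ j)))
               (∑-cong r₂ λ j → cong indicator (adj-⊕-join s (inj₂ j))))

  edges-⊕ : edges (G₁ ⊕ G₂) ≡ edges G₁ + edges G₂
  edges-⊕ = trans (∑-+ l₁ l₂ (degree (G₁ ⊕ G₂))) (cong₂ _+_ (∑-cong l₁ degreeˡ) (∑-cong l₂ degreeʳ))
    where
    degreeˡ : ∀ i → degree (G₁ ⊕ G₂) (i ↑ˡ l₂) ≡ degree G₁ i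
    degreeˡ i = trans (degree-⊕-join (inj₁ i)) (trans (cong (degree G₁ i +_) (∑-zero r₂)) (+-identityʳ _))
    degreeʳ : ∀ i → degree (G₁ ⊕ G₂) (l₁ ↑ʳ i) ≡ degree G₂ i
    degreeʳ i = trans (degree-⊕-join (inj₂ i)) (cong (_+ degree G₂ i) (∑-zero r₁))

edges-copies : ∀ k G → edges (copies k G) ≡ k * edges G
edges-copies zero    G = edges-emptyGraph 0 0
edges-copies (suc k) G = trans (edges-⊕ G (copies k G)) (cong (edges G +_) (edges-copies k G))

inFirst : ∀ {A B : Set} → A ⊎ B → Bool
inFirst (inj₁ _) = true
inFirst (inj₂ _) = false

-- The summands are indexed by a Boolean c so that the two sides are treated uniformly:
-- pick recovers the component of an element of F true ⊎ F false lying on side c.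
pick : ∀ {F : Bool → Set} {c} (s : F true ⊎ F false) → inFirst s ≡ c → F c
pick (inj₁ x) refl = x
pick (inj₂ y) refl = y

pick-injective : ∀ {F : Bool → Set} {c} (s t : F true ⊎ F false)
                 (p : inFirst s ≡ c) (q : inFirst t ≡ c) → pick {F} s p ≡ pick {F} t q → s ≡ t
pick-injective (inj₁ _) (inj₁ _) refl refl eq = cong inj₁ eq
pick-injective (inj₂ _) (inj₂ _) refl refl eq = cong inj₂ eq
pick-injective (inj₁ _) (inj₂ _) refl ()
pick-injective (inj₂ _) (inj₁ _) refl ()

splitAt-injective : ∀ m {n} {x y : Fin (m + n)} → splitAt m x ≡ splitAt m y → x ≡ y
splitAt-injective m {n} {x} {y} eq =
  trans (sym (join-splitAt m n x)) (trans (cong (join m n) eq) (join-splitAt m n y))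

someVertex : (H : SBG) → 1 ≤ left H + right H → Vertex H
someVertex (sbg (suc _) _       _) _ = inj₁ Fin.zero
someVertex (sbg zero    (suc _) _) _ = inj₂ Fin.zero

module _ {G₁ G₂ : SBG} where
  private
    l₁ = left G₁
    r₁ = right G₁
    A  = adj G₁
    B  = adj G₂

    summand : Bool → SBG
    summand true  = G₁
    summand false = G₂

    blockˡ : Fin (left (G₁ ⊕ G₂)) → Bool
    blockˡ x = inFirst (splitAt l₁ x)

    blockʳ : Fin (right (G₁ ⊕ G₂)) → Bool
    blockʳ y = inFirst (splitAt r₁ y)

    restrictˡ : ∀ {c} x → blockˡ x ≡ c → Fin (left (summand c))
    restrictˡ x = pick {F = λ c → Fin (left (summand c))} (splitAt l₁ x)

    restrictʳ : ∀ {c} y → blockʳ y ≡ c → Fin (right (summand c))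
    restrictʳ y = pick {F = λ c → Fin (right (summand c))} (splitAt r₁ y)

    blockDiagonal-inFirst : ∀ s t → blockDiagonal A B s t ≡ true → inFirst s ≡ inFirst t
    blockDiagonal-inFirst (inj₁ _) (inj₁ _) _ = refl
    blockDiagonal-inFirst (inj₂ _) (inj₂ _) _ = refl

    blockDiagonal-pick : ∀ {c} s t (p : inFirst s ≡ c) (q : inFirst t ≡ c) → blockDiagonal A B s t ≡ true →
                         adj (summand c) (pick {F = λ c → Fin (left (summand c))} s p)
                                         (pick {F = λ c → Fin (right (summand c))} t q) ≡ true
    blockDiagonal-pick (inj₁ _) (inj₁ _) refl refl e = e
    blockDiagonal-pick (inj₂ _) (inj₂ _) refl refl e = e

    restrictˡ-injective : ∀ {c} x x′ (p : blockˡ x ≡ c) (q : blockˡ x′ ≡ c) →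
                          restrictˡ x p ≡ restrictˡ x′ q → x ≡ x′
    restrictˡ-injective x x′ p q =
      splitAt-injective l₁ ∘ pick-injective {F = λ c → Fin (left (summand c))} (splitAt l₁ x) (splitAt l₁ x′) p q

    restrictʳ-injective : ∀ {c} y y′ (p : blockʳ y ≡ c) (q : blockʳ y′ ≡ c) →
                          restrictʳ y p ≡ restrictʳ y′ q → y ≡ y′
    restrictʳ-injective y y′ p q =
      splitAt-injective r₁ ∘ pick-injective {F = λ c → Fin (right (summand c))} (splitAt r₁ y) (splitAt r₁ y′) p q

    restrict-edge : ∀ {c} x y (p : blockˡ x ≡ c) (q : blockʳ y ≡ c) → adj (G₁ ⊕ G₂) x y ≡ true →
                    adj (summand c) (restrictˡ x p) (restrictʳ y q) ≡ true
    restrict-edge x y = blockDiagonal-pick (splitAt l₁ x) (splitAt r₁ y)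

    inSummand : ∀ {H} c → SignedCopy H (summand c) → SignedCopy H G₁ ⊎ SignedCopy H G₂
    inSummand true  = inj₁
    inSummand false = inj₂

  copy-⊕ : ∀ {H} → Connected H → SignedCopy H (G₁ ⊕ G₂) → SignedCopy H G₁ ⊎ SignedCopy H G₂
  copy-⊕ {H} (nonempty , reach) (f , g , f-injective , g-injective , f×g-edge) =
    inSummand c (f′ , g′ , f′-injective , g′-injective , f′×g′-edge)
    where
    block : Vertex H → Bool
    block (inj₁ i) = blockˡ (f i)
    block (inj₂ j) = blockʳ (g j)

    block-adj : ∀ u v → Adj H u v → block u ≡ block v
    block-adj (inj₁ i) (inj₂ j) e = blockDiagonal-inFirst _ _ (f×g-edge i j e)
    block-adj (inj₂ j) (inj₁ i) e = sym (blockDiagonal-inFirst _ _ (f×g-edge i j e))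

    block-reach : ∀ {u v} → Reach H u v → block u ≡ block v
    block-reach here                = refl
    block-reach (step {u} {v} e uv) = trans (block-adj u v e) (block-reach uv)

    c : Bool
    c = block (someVertex H nonempty)

    same-block : ∀ u → block u ≡ c
    same-block u = block-reach (reach u (someVertex H nonempty))

    f′ : Fin (left H) → Fin (left (summand c))
    f′ i = restrictˡ (f i) (same-block (inj₁ i))

    g′ : Fin (right H) → Fin (right (summand c))
    g′ j = restrictʳ (g j) (same-block (inj₂ j))

    f′-injective : ∀ {i i′} → f′ i ≡ f′ i′ → i ≡ i′
    f′-injective {i} {i′} =
      f-injective ∘ restrictˡ-injective (f i) (f i′) (same-block (inj₁ i)) (same-block (inj₁ i′))

    g′-injective : ∀ {j j′} → g′ j ≡ g′ j′ → j ≡ j′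
    g′-injective {j} {j′} =
      g-injective ∘ restrictʳ-injective (g j) (g j′) (same-block (inj₂ j)) (same-block (inj₂ j′))

    f′×g′-edge : ∀ i j → adj H i j ≡ true → adj (summand c) (f′ i) (g′ j) ≡ true
    f′×g′-edge i j e =
      restrict-edge (f i) (g j) (same-block (inj₁ i)) (same-block (inj₂ j)) (f×g-edge i j e)

Edgeless : SBG → Set
Edgeless H = ∀ i j → adj H i j ≡ true → ⊥

copy-in-emptyGraph⇒edgeless : ∀ {H l r} → SignedCopy H (emptyGraph l r) → Edgeless H
copy-in-emptyGraph⇒edgeless (_ , _ , _ , _ , f×g-edge) i j e with f×g-edge i j e
... | ()

reach-edgeless : ∀ {H u v} → Edgeless H → Reach H u v → u ≡ v
reach-edgeless none here                         = refl
reach-edgeless none (step {inj₁ i} {inj₂ j} e _) = ⊥-elim (none i j e)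
reach-edgeless none (step {inj₂ j} {inj₁ i} e _) = ⊥-elim (none i j e)
reach-edgeless none (step {inj₁ _} {inj₁ _} () _)
reach-edgeless none (step {inj₂ _} {inj₂ _} () _)

edgeless-copy : ∀ {H} → Connected H → (G : SBG) → Fin (left G) → Fin (right G) →
                Edgeless H → SignedCopy H G
edgeless-copy (_ , reach) G i₀ j₀ none =
  (λ _ → i₀) , (λ _ → j₀) ,
  (λ {i} {i′} _ → inj₁-injective (reach-edgeless none (reach (inj₁ i) (inj₁ i′)))) ,
  (λ {j} {j′} _ → inj₂-injective (reach-edgeless none (reach (inj₂ j) (inj₂ j′)))) ,
  (λ i j e → ⊥-elim (none i j e))

-- A copy of H in an empty graph makes H edgeless, hence a single vertex, which embeds in G.
emptyGraph-free : ∀ {H} → Connected H → (G : SBG) → Fin (left G) → Fin (right G) → HFree H G →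
                  ∀ l r → HFree H (emptyGraph l r)
emptyGraph-free conn G i₀ j₀ free l r = free ∘ edgeless-copy conn G i₀ j₀ ∘ copy-in-emptyGraph⇒edgeless

⊕-free : ∀ {H G₁ G₂} → Connected H → HFree H G₁ → HFree H G₂ → HFree H (G₁ ⊕ G₂)
⊕-free conn free₁ free₂ = [ free₁ , free₂ ] ∘ copy-⊕ conn

copies-free : ∀ {H} → Connected H → (G : SBG) → Fin (left G) → Fin (right G) → HFree H G →
              ∀ k → HFree H (copies k G)
copies-free conn G i₀ j₀ free zero    = emptyGraph-free conn G i₀ j₀ free 0 0
copies-free conn G i₀ j₀ free (suc k) = ⊕-free conn free (copies-free conn G i₀ j₀ free k)

IsZ-upper : ∀ {m n H z} → IsZ m n H z →
            (G : SBG) → left G ≡ m → right G ≡ n → HFree H G → edges G ≤ z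
IsZ-upper (_ , maximal) (sbg _ _ A) refl refl = maximal A

*-IsZ≤IsZ : ∀ {H a b m n z′ z} → Connected H → IsZ (suc a) (suc b) H z′ → IsZ m n H z →
            ∀ k → k * suc a ≤ m → k * suc b ≤ n → k * z′ ≤ z
*-IsZ≤IsZ {H} {a} {b} {m} {n} {z′} conn ((A , free , edges≡z′) , _) zmn k ka≤m kb≤n =
  subst (_≤ _) edges-padded (IsZ-upper zmn padded left-padded right-padded padded-free)
  where
  G = sbg (suc a) (suc b) A
  padding = emptyGraph (m ∸ k * suc a) (n ∸ k * suc b)
  padded = copies k G ⊕ padding

  left-padded : left padded ≡ m
  left-padded = trans (cong (_+ (m ∸ k * suc a)) (left-copies k G)) (m+[n∸m]≡n ka≤m)

  right-padded : right padded ≡ n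
  right-padded = trans (cong (_+ (n ∸ k * suc b)) (right-copies k G)) (m+[n∸m]≡n kb≤n)

  padded-free : HFree H padded
  padded-free = ⊕-free conn (copies-free conn G Fin.zero Fin.zero free k)
                            (emptyGraph-free conn G Fin.zero Fin.zero free _ _)

  edges-padded : edges padded ≡ k * z′
  edges-padded = begin
    edges padded                        ≡⟨ edges-⊕ (copies k G) padding ⟩
    edges (copies k G) + edges padding  ≡⟨ cong₂ _+_ (edges-copies k G) (edges-emptyGraph (left padding) (right padding)) ⟩
    k * edges G + 0                     ≡⟨ +-identityʳ _ ⟩
    k * edges G                         ≡⟨ cong (k *_) edges≡z′ ⟩
    k * z′                              ∎
    where open ≡-Reasoning

m≤2*[m/n*n] : ∀ m n .{{_ : NonZero n}} → n ≤ m → m ≤ 2 * (m / n * n)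
m≤2*[m/n*n] m n n≤m = begin
  m                            ≡⟨ m≡m%n+[m/n]*n m n ⟩
  m % n + m / n * n            ≤⟨ +-monoˡ-≤ (m / n * n) (≤-trans (<⇒≤ (m%n<n m n)) n≤m/n*n) ⟩
  m / n * n + m / n * n        ≡⟨ cong (m / n * n +_) (sym (+-identityʳ _)) ⟩
  2 * (m / n * n)              ∎
  where
  open ≤-Reasoning
  n≤m/n*n : n ≤ m / n * n
  n≤m/n*n = ≤-trans (≤-reflexive (sym (*-identityˡ n))) (*-monoˡ-≤ n (m≥n⇒m/n>0 n≤m))

m*n≤2*[a*n⊔b*m]*[m/a⊓n/b] : ∀ m n a b .{{_ : NonZero a}} .{{_ : NonZero b}} → a ≤ m → b ≤ n →
                            m * n ≤ 2 * (a * n ⊔ b * m) * ((m / a) ⊓ (n / b))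
m*n≤2*[a*n⊔b*m]*[m/a⊓n/b] m n a b a≤m b≤n with ⊓-sel (m / a) (n / b)
... | inj₁ min≡m/a rewrite min≡m/a = begin
  m * n                        ≤⟨ *-monoˡ-≤ n (m≤2*[m/n*n] m a a≤m) ⟩
  2 * (m / a * a) * n          ≡⟨ solve 3 (λ q a n → con 2 :* (q :* a) :* n := con 2 :* (a :* n) :* q) refl (m / a) a n ⟩
  2 * (a * n) * (m / a)        ≤⟨ *-monoˡ-≤ (m / a) (*-monoʳ-≤ 2 (m≤m⊔n (a * n) (b * m))) ⟩
  2 * (a * n ⊔ b * m) * (m / a) ∎
  where open ≤-Reasoning; open +-*-Solver
... | inj₂ min≡n/b rewrite min≡n/b = begin
  m * n                        ≤⟨ *-monoʳ-≤ m (m≤2*[m/n*n] n b b≤n) ⟩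
  m * (2 * (n / b * b))        ≡⟨ solve 3 (λ q b m → m :* (con 2 :* (q :* b)) := con 2 :* (b :* m) :* q) refl (n / b) b m ⟩
  2 * (b * m) * (n / b)        ≤⟨ *-monoˡ-≤ (n / b) (*-monoʳ-≤ 2 (m≤n⊔m (a * n) (b * m))) ⟩
  2 * (a * n ⊔ b * m) * (n / b) ∎
  where open ≤-Reasoning; open +-*-Solver

[m/n⊓o]*n≤m : ∀ m n o .{{_ : NonZero n}} → ((m / n) ⊓ o) * n ≤ m
[m/n⊓o]*n≤m m n o = ≤-trans (*-monoˡ-≤ n (m⊓n≤m (m / n) o)) (m/n*n≤m m n)

lemma4p2 : (H : SBG) → Connected H →
    (m n a b : ℕ) → 1 ≤ a → a ≤ m → 1 ≤ b → b ≤ n →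
    (z z' : ℕ) → IsZ m n H z → IsZ a b H z' →
    m * n * z' ≤ 2 * ((a * n) ⊔ (b * m)) * z
lemma4p2 H conn m n a@(suc _) b@(suc _) (s≤s z≤n) a≤m (s≤s z≤n) b≤n z z′ zmn zab = begin
  m * n * z′            ≤⟨ *-monoˡ-≤ z′ (m*n≤2*[a*n⊔b*m]*[m/a⊓n/b] m n a b a≤m b≤n) ⟩
  2 * M * k * z′        ≡⟨ *-assoc (2 * M) k z′ ⟩
  2 * M * (k * z′)      ≤⟨ *-monoʳ-≤ (2 * M) (*-IsZ≤IsZ conn zab zmn k ka≤m kb≤n) ⟩
  2 * M * z             ∎
  where
  open ≤-Reasoning
  M = a * n ⊔ b * m
  k = (m / a) ⊓ (n / b)
  ka≤m : k * a ≤ m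
  ka≤m = [m/n⊓o]*n≤m m a (n / b)
  kb≤n : k * b ≤ n
  kb≤n = subst (λ k → k * b ≤ n) (⊓-comm (n / b) (m / a)) ([m/n⊓o]*n≤m n b (m / a))
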